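{- Let $n\ge1$ and let $(a_1,\dots,a_n)$ be a sequence of integers with $0\le a_i<i$ for all $i$. Let $C_k^-\in S_n$ denote the $k$-cycle $(k,k-1,\dots,1)$, i.e. $C_k^-(1)=k$, $C_k^-(j)=j-1$ for $2\le j\le k$, and $C_k^-(j)=j$ for $j>k$. Let $$\sigma=(C_n^-)^{a_n}\circ(C_{n-1}^-)^{a_{n-1}}\circ\cdots\circ(C_2^-)^{a_2}\in S_n,$$ where permutations are composed as functions (the rightmost factor is applied first). Then $$\mathbf{maj}(\sigma)=\sum_{i=1}^n a_i,\qquad \mathbf{siz}(\sigma)=\sum_{i=1}^n(n+1-i)\,a_i .$$
   Context: For $\sigma\in S_n$, written in one-line notation $\sigma(1)\sigma(2)\cdots\sigma(n)$: the descent set is $\mathbf{DES}(\sigma)=\{i\in[1,n-1]:\sigma(i)>\sigma(i+1)\}$; the major index is $\mathbf{maj}(\sigma)=\sum_{i\in\mathbf{DES}(\sigma)}i$; the inversion number is $\mathbf{inv}(\sigma)=|\{(i,j):1\le i<j\le n,\ \sigma(i)>\sigma(j)\}|$; and the size statistic is $\mathbf{siz}(\sigma)=\Big(\sum_{i\in\mathbf{DES}(\sigma)}(n+1-i)\,i\Big)-\mathbf{inv}(\sigma)$. -}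

module Defs where

open import Data.Nat using (ℕ; zero; suc; _+_; _*_; _∸_; _<ᵇ_; _≡ᵇ_; _≤ᵇ_)
open import Data.Bool using (Bool; true; false; if_then_else_)
open import Data.Integer using (ℤ; +_; _-_)
open import Function using (id; _∘_)

-- Permutations of [1,n] are represented as functions ℕ → ℕ; only the values
-- on 1..n matter. σ(j) is the j-th entry of the one-line notation.
Perm : Set
Perm = ℕ → ℕ

C⁻ : ℕ → Perm
C⁻ k j = if j ≡ᵇ 1 then k else (if j ≤ᵇ k then j ∸ 1 else j)

_^ᵖ_ : Perm → ℕ → Perm
f ^ᵖ zero  = id
f ^ᵖ suc m = f ∘ (f ^ᵖ m)

σseq : (ℕ → ℕ) → ℕ → Perm
σseq a zero = id
σseq a (suc zero) = id
σseq a (suc (suc m)) = ((C⁻ (suc (suc m))) ^ᵖ a (suc (suc m))) ∘ σseq a (suc m)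

sumFrom1 : ℕ → (ℕ → ℕ) → ℕ
sumFrom1 zero f = 0
sumFrom1 (suc n) f = sumFrom1 n f + f (suc n)

𝟙 : Bool → ℕ
𝟙 true = 1
𝟙 false = 0

isDes : ℕ → Perm → ℕ → Bool
isDes n σ i = if (i <ᵇ n) then (σ (suc i) <ᵇ σ i) else false

maj : ℕ → Perm → ℕ
maj n σ = sumFrom1 n (λ i → 𝟙 (isDes n σ i) * i)

inv : ℕ → Perm → ℕ
inv n σ = sumFrom1 n (λ j → sumFrom1 j (λ i → 𝟙 (i <ᵇ j) * 𝟙 (σ j <ᵇ σ i)))

siz : ℕ → Perm → ℤ
siz n σ = + sumFrom1 n (λ i → 𝟙 (isDes n σ i) * ((suc n ∸ i) * i)) - + inv n σ

module Submission where

-- Writing W σ = Σ_{i ∈ DES σ} (n+1-i) i, so that siz = W - inv, the pair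
-- (maj, siz) is tracked by the predicate HasStats, which states the siz part
-- in ℕ as  W ≡ inv + T.  Two facts drive the induction:
--  * Lifting: a permutation τ of [1,n] read in S_{n+1} (so τ(n+1) = n+1)
--    keeps its descents and inversions, while each descent i gains weight i
--    in W; hence maj is unchanged and siz grows by maj τ.
--  * Rotation: if ρ ∈ S_N carries the value 1 at position p < N, then
--    C⁻ N ∘ ρ lowers every other value by one and puts N at p.  The descent
--    at p-1 moves to p, and the entry at p trades its p-1 inversions with
--    earlier entries for N-p inversions with later ones; so maj and siz
--    both grow by exactly 1.
-- Starting from τ = σseq a n, which fixes N = n+1, the k-th rotation finds
-- N-k at position N, so the rotation step applies a N ≤ n times.

open import Defs
open import Data.Nat using (ℕ; zero; suc; _+_; _*_; _∸_; _≤_; _<_; _<ᵇ_; _≤ᵇ_; _≡ᵇ_; z≤n; s≤s)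
open import Data.Nat.Properties
open import Data.Nat.Tactic.RingSolver using (solve-∀)
open import Data.Bool using (true; false; T; if_then_else_)
open import Data.Unit using (tt)
open import Data.Integer using (+_)
import Data.Integer as ℤ
import Data.Integer.Properties as ℤ
open import Data.Product using (_×_; _,_; proj₁; proj₂)
open import Data.Empty using (⊥-elim)
open import Function using (_∘_; id)
open import Relation.Binary.PropositionalEquality
open import Relation.Binary.Definitions using (tri<; tri≈; tri>)
open import Relation.Nullary using (yes; no)

<ᵇ-true : ∀ {m n} → m < n → (m <ᵇ n) ≡ true
<ᵇ-true {zero} {suc n} _ = refl
<ᵇ-true {suc m} {suc n} (s≤s m<n) = <ᵇ-true m<n

<ᵇ-false : ∀ {m n} → n ≤ m → (m <ᵇ n) ≡ false
<ᵇ-false {m} {zero} _ = refl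
<ᵇ-false {suc m} {suc n} (s≤s n≤m) = <ᵇ-false n≤m

≤ᵇ-true : ∀ {m n} → m ≤ n → (m ≤ᵇ n) ≡ true
≤ᵇ-true {zero} _ = refl
≤ᵇ-true {suc m} m≤n = <ᵇ-true m≤n

≤ᵇ-false : ∀ {m n} → n < m → (m ≤ᵇ n) ≡ false
≤ᵇ-false {suc m} (s≤s n≤m) = <ᵇ-false n≤m

≡ᵇ-refl : ∀ n → (n ≡ᵇ n) ≡ true
≡ᵇ-refl zero = refl
≡ᵇ-refl (suc n) = ≡ᵇ-refl n

≡ᵇ-false : ∀ {m n} → m ≢ n → (m ≡ᵇ n) ≡ false
≡ᵇ-false {zero} {zero} m≢n = ⊥-elim (m≢n refl)
≡ᵇ-false {zero} {suc n} _ = refl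
≡ᵇ-false {suc m} {zero} _ = refl
≡ᵇ-false {suc m} {suc n} m≢n = ≡ᵇ-false (m≢n ∘ cong suc)

-- A factor 𝟙 b only needs its cofactors to agree when b holds; this is how
-- every case split on a guard [i < j] or [i ∈ DES] is discharged.
𝟙*-cong : ∀ b {x y} → (T b → x ≡ y) → 𝟙 b * x ≡ 𝟙 b * y
𝟙*-cong true x≡y = cong (_+ 0) (x≡y tt)
𝟙*-cong false _ = refl

sum-cong : ∀ n {f g : ℕ → ℕ} → (∀ i → 1 ≤ i → i ≤ n → f i ≡ g i) → sumFrom1 n f ≡ sumFrom1 n g
sum-cong zero _ = refl
sum-cong (suc n) f≡g =
  cong₂ _+_ (sum-cong n (λ i 1≤i i≤n → f≡g i 1≤i (m≤n⇒m≤1+n i≤n))) (f≡g (suc n) (s≤s z≤n) ≤-refl)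

sum-+ : ∀ n (f g : ℕ → ℕ) → sumFrom1 n (λ i → f i + g i) ≡ sumFrom1 n f + sumFrom1 n g
sum-+ zero f g = refl
sum-+ (suc n) f g rewrite sum-+ n f g = interchange (sumFrom1 n f) (sumFrom1 n g) (f (suc n)) (g (suc n))
  where
  interchange : ∀ a b c d → (a + b) + (c + d) ≡ (a + c) + (b + d)
  interchange = solve-∀

sum-zero : ∀ n (f : ℕ → ℕ) → (∀ i → 1 ≤ i → i ≤ n → f i ≡ 0) → sumFrom1 n f ≡ 0
sum-zero zero f _ = refl
sum-zero (suc n) f f≡0 rewrite sum-zero n f (λ i 1≤i i≤n → f≡0 i 1≤i (m≤n⇒m≤1+n i≤n)) =
  f≡0 (suc n) (s≤s z≤n) ≤-refl

sum-delta-out : ∀ n q (w : ℕ → ℕ) → n < q → sumFrom1 n (λ i → 𝟙 (i ≡ᵇ q) * w i) ≡ 0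
sum-delta-out n q w n<q =
  sum-zero n _ (λ i _ i≤n → cong (λ b → 𝟙 b * w i) (≡ᵇ-false (<⇒≢ (≤-<-trans i≤n n<q))))

sum-delta : ∀ n q (w : ℕ → ℕ) → 1 ≤ q → q ≤ n → sumFrom1 n (λ i → 𝟙 (i ≡ᵇ q) * w i) ≡ w q
sum-delta zero q w 1≤q q≤0 = ⊥-elim (<⇒≱ 1≤q q≤0)
sum-delta (suc n) q w 1≤q q≤n with q ≟ suc n
... | yes refl rewrite sum-delta-out n (suc n) w ≤-refl | ≡ᵇ-refl n = +-identityʳ (w (suc n))
... | no q≢n rewrite sum-delta n q w 1≤q (≤-pred (≤∧≢⇒< q≤n q≢n)) | ≡ᵇ-false (q≢n ∘ sym) =
  +-identityʳ (w q)

sum-delta₀ : ∀ n q (w : ℕ → ℕ) → w 0 ≡ 0 → q ≤ n → sumFrom1 n (λ i → 𝟙 (i ≡ᵇ q) * w i) ≡ w q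
sum-delta₀ n zero w w0≡0 _ = trans (sum-zero n _ (λ { (suc i) _ _ → refl })) (sym w0≡0)
sum-delta₀ n (suc q) w _ q≤n = sum-delta n (suc q) w (s≤s z≤n) q≤n

count-below-prefix : ∀ k j c → k < j → sumFrom1 k (λ i → 𝟙 (i <ᵇ j) * c) ≡ k * c
count-below-prefix zero j c _ = refl
count-below-prefix (suc k) j c k<j
  rewrite count-below-prefix k j c (<-trans (n<1+n k) k<j) | <ᵇ-true k<j | +-identityʳ c = +-comm (k * c) c

count-below : ∀ j c → sumFrom1 j (λ i → 𝟙 (i <ᵇ j) * c) ≡ (j ∸ 1) * c
count-below zero c = refl
count-below (suc m) c rewrite count-below-prefix m (suc m) c ≤-refl | <ᵇ-false {suc m} {suc m} ≤-refl =
  +-identityʳ (m * c)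

count-above : ∀ N p → sumFrom1 N (λ j → 𝟙 (p <ᵇ j)) ≡ N ∸ p
count-above zero p = sym (0∸n≡0 p)
count-above (suc N) p with p ≤? N
... | yes p≤N rewrite count-above N p | <ᵇ-true (s≤s p≤N) = trans (sym (+-∸-comm 1 p≤N)) (cong (_∸ p) (+-comm N 1))
... | no p≰N rewrite count-above N p | <ᵇ-false {p} {suc N} (≰⇒> p≰N)
                   | m≤n⇒m∸n≡0 (<⇒≤ (≰⇒> p≰N)) | m≤n⇒m∸n≡0 (≰⇒> p≰N) = refl

suc∸-* : ∀ m i x → i ≤ m → (suc m ∸ i) * x ≡ (m ∸ i) * x + x
suc∸-* m i x i≤m rewrite +-∸-assoc 1 i≤m = +-comm x ((m ∸ i) * x)

-- Permutations of [1,N]: maps of ℕ that restrict to a bijection of [1,N],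
-- given together with an inverse.  Needed to locate the value 1 and to know
-- that it occurs at exactly one position.

MapsInto : ℕ → Perm → Set
MapsInto N ρ = ∀ i → 1 ≤ i → i ≤ N → 1 ≤ ρ i × ρ i ≤ N

record IsPermOn (N : ℕ) (ρ : Perm) : Set where
  field
    maps-into : MapsInto N ρ
    inverse : Perm
    inverse-maps-into : MapsInto N inverse
    left-inverse : ∀ i → 1 ≤ i → i ≤ N → inverse (ρ i) ≡ i
    right-inverse : ∀ v → 1 ≤ v → v ≤ N → ρ (inverse v) ≡ v

id-perm : ∀ N → IsPermOn N id
id-perm N = record
  { maps-into = λ _ 1≤i i≤N → 1≤i , i≤N
  ; inverse = id
  ; inverse-maps-into = λ _ 1≤i i≤N → 1≤i , i≤N
  ; left-inverse = λ _ _ _ → refl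
  ; right-inverse = λ _ _ _ → refl
  }

∘-into : ∀ {N f g} → MapsInto N f → MapsInto N g → MapsInto N (f ∘ g)
∘-into {g = g} f-into g-into i 1≤i i≤N = f-into (g i) (g-into i 1≤i i≤N .proj₁) (g-into i 1≤i i≤N .proj₂)

∘-perm : ∀ {N f g} → IsPermOn N f → IsPermOn N g → IsPermOn N (f ∘ g)
∘-perm {N} {f} {g} F G = record
  { maps-into = ∘-into F.maps-into G.maps-into
  ; inverse = G.inverse ∘ F.inverse
  ; inverse-maps-into = ∘-into G.inverse-maps-into F.inverse-maps-into
  ; left-inverse = λ i 1≤i i≤N →
      let gi-in : 1 ≤ g i × g i ≤ N
          gi-in = G.maps-into i 1≤i i≤N in
      trans (cong G.inverse (F.left-inverse (g i) (gi-in .proj₁) (gi-in .proj₂))) (G.left-inverse i 1≤i i≤N)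
  ; right-inverse = λ v 1≤v v≤N →
      let f⁻¹v-in : 1 ≤ F.inverse v × F.inverse v ≤ N
          f⁻¹v-in = F.inverse-maps-into v 1≤v v≤N in
      trans (cong f (G.right-inverse (F.inverse v) (f⁻¹v-in .proj₁) (f⁻¹v-in .proj₂))) (F.right-inverse v 1≤v v≤N)
  }
  where
  module F = IsPermOn F
  module G = IsPermOn G

^-perm : ∀ {N f} k → IsPermOn N f → IsPermOn N (f ^ᵖ k)
^-perm {N} zero _ = id-perm N
^-perm (suc k) F = ∘-perm F (^-perm k F)

C⁻-shift : ∀ k j → 2 ≤ j → j ≤ k → C⁻ k j ≡ j ∸ 1
C⁻-shift k (suc (suc j)) _ j≤k rewrite ≤ᵇ-true j≤k = refl
C⁻-shift k (suc zero) (s≤s ()) _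

C⁻-fix : ∀ k j → 1 ≤ k → k < j → C⁻ k j ≡ j
C⁻-fix k (suc (suc j)) _ k<j rewrite ≤ᵇ-false k<j = refl
C⁻-fix (suc k) (suc zero) _ (s≤s ())

C⁻-below-top : ∀ N y → 2 ≤ y → y ≤ N → (C⁻ N y <ᵇ N) ≡ true
C⁻-below-top N (suc (suc y)) 2≤y y≤N rewrite C⁻-shift N _ 2≤y y≤N = <ᵇ-true y≤N
C⁻-below-top N (suc zero) (s≤s ()) _

C⁻-top-not-below : ∀ N x → 2 ≤ x → x ≤ N → (N <ᵇ C⁻ N x) ≡ false
C⁻-top-not-below N (suc (suc x)) 2≤x x≤N rewrite C⁻-shift N _ 2≤x x≤N = <ᵇ-false (≤-trans (n≤1+n _) x≤N)
C⁻-top-not-below N (suc zero) (s≤s ()) _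

C⁻-monotone : ∀ N x y → 2 ≤ x → x ≤ N → 2 ≤ y → y ≤ N → (C⁻ N y <ᵇ C⁻ N x) ≡ (y <ᵇ x)
C⁻-monotone N (suc (suc x)) (suc (suc y)) 2≤x x≤N 2≤y y≤N
  rewrite C⁻-shift N _ 2≤x x≤N | C⁻-shift N _ 2≤y y≤N = refl
C⁻-monotone N (suc zero) y (s≤s ()) _ _ _
C⁻-monotone N (suc (suc x)) (suc zero) _ _ (s≤s ()) _

C⁺ : ℕ → Perm
C⁺ k v = if v ≡ᵇ k then 1 else (if v <ᵇ k then suc v else v)

C⁺-top : ∀ k → C⁺ k k ≡ 1
C⁺-top k rewrite ≡ᵇ-refl k = refl

C⁺-shift : ∀ k v → v < k → C⁺ k v ≡ suc v
C⁺-shift k v v<k rewrite ≡ᵇ-false (<⇒≢ v<k) | <ᵇ-true v<k = refl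

C⁺-fix : ∀ k v → k < v → C⁺ k v ≡ v
C⁺-fix k v k<v rewrite ≡ᵇ-false (≢-sym (<⇒≢ k<v)) | <ᵇ-false (<⇒≤ k<v) = refl

C⁻-perm : ∀ M k → 1 ≤ k → k ≤ M → IsPermOn M (C⁻ k)
C⁻-perm M k 1≤k k≤M = record
  { maps-into = into
  ; inverse = C⁺ k
  ; inverse-maps-into = inverse-into
  ; left-inverse = left
  ; right-inverse = right
  }
  where
  into : MapsInto M (C⁻ k)
  into (suc zero) _ _ = 1≤k , k≤M
  into (suc (suc j)) 1≤j j≤M with suc (suc j) ≤? k
  ... | yes j≤k rewrite C⁻-shift k (suc (suc j)) (s≤s (s≤s z≤n)) j≤k = s≤s z≤n , ≤-trans (n≤1+n (suc j)) j≤M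
  ... | no j≰k rewrite C⁻-fix k (suc (suc j)) 1≤k (≰⇒> j≰k) = 1≤j , j≤M
  inverse-into : MapsInto M (C⁺ k)
  inverse-into v 1≤v v≤M with <-cmp v k
  ... | tri< v<k _ _ rewrite C⁺-shift k v v<k = s≤s z≤n , ≤-trans v<k k≤M
  ... | tri≈ _ refl _ rewrite C⁺-top v = s≤s z≤n , ≤-trans 1≤k k≤M
  ... | tri> _ _ k<v rewrite C⁺-fix k v k<v = 1≤v , v≤M
  left : ∀ i → 1 ≤ i → i ≤ M → C⁺ k (C⁻ k i) ≡ i
  left (suc zero) _ _ = C⁺-top k
  left (suc (suc j)) _ _ with suc (suc j) ≤? k
  ... | yes j≤k rewrite C⁻-shift k (suc (suc j)) (s≤s (s≤s z≤n)) j≤k = C⁺-shift k (suc j) j≤k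
  ... | no j≰k rewrite C⁻-fix k (suc (suc j)) 1≤k (≰⇒> j≰k) = C⁺-fix k _ (≰⇒> j≰k)
  right : ∀ v → 1 ≤ v → v ≤ M → C⁻ k (C⁺ k v) ≡ v
  right v 1≤v _ with <-cmp v k
  ... | tri< v<k _ _ rewrite C⁺-shift k v v<k = C⁻-shift k (suc v) (s≤s 1≤v) v<k
  ... | tri≈ _ refl _ rewrite C⁺-top v = refl
  ... | tri> _ _ k<v rewrite C⁺-fix k v k<v = C⁻-fix k v 1≤k k<v

C⁻^-fix : ∀ k j m → 1 ≤ k → k < j → (C⁻ k ^ᵖ m) j ≡ j
C⁻^-fix k j zero _ _ = refl
C⁻^-fix k j (suc m) 1≤k k<j rewrite C⁻^-fix k j m 1≤k k<j = C⁻-fix k j 1≤k k<j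

C⁻^-top : ∀ N k → suc k < N → (C⁻ N ^ᵖ k) N ≡ N ∸ k
C⁻^-top N zero _ = refl
C⁻^-top N (suc k) k<N rewrite C⁻^-top N k (<-trans (n<1+n _) k<N) =
  trans (C⁻-shift N (N ∸ k) (m+n≤o⇒m≤o∸n 2 (<⇒≤ k<N)) (m∸n≤m N k))
        (trans (∸-+-assoc N k 1) (cong (N ∸_) (+-comm k 1)))

σseq-perm : ∀ a n M → n ≤ M → IsPermOn M (σseq a n)
σseq-perm a zero M _ = id-perm M
σseq-perm a (suc zero) M _ = id-perm M
σseq-perm a (suc (suc m)) M m≤M =
  ∘-perm (^-perm (a (suc (suc m))) (C⁻-perm M _ (s≤s z≤n) m≤M))
         (σseq-perm a (suc m) M (≤-trans (n≤1+n _) m≤M))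

σseq-fix : ∀ a n j → n < j → σseq a n j ≡ j
σseq-fix a zero j _ = refl
σseq-fix a (suc zero) j _ = refl
σseq-fix a (suc (suc m)) j m<j rewrite σseq-fix a (suc m) j (<-trans (n<1+n _) m<j) =
  C⁻^-fix (suc (suc m)) j (a (suc (suc m))) (s≤s z≤n) m<j

desSum : ℕ → Perm → (ℕ → ℕ) → ℕ
desSum N σ w = sumFrom1 N (λ i → 𝟙 (isDes N σ i) * w i)

sizWeight : ℕ → ℕ → ℕ
sizWeight N i = (suc N ∸ i) * i

desSum-cong : ∀ N σ {v w : ℕ → ℕ} → (∀ i → 1 ≤ i → i ≤ N → v i ≡ w i) → desSum N σ v ≡ desSum N σ w
desSum-cong N σ v≡w = sum-cong N (λ i 1≤i i≤N → cong (𝟙 (isDes N σ i) *_) (v≡w i 1≤i i≤N))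

desSum-+ : ∀ N σ (v w : ℕ → ℕ) → desSum N σ (λ i → v i + w i) ≡ desSum N σ v + desSum N σ w
desSum-+ N σ v w =
  trans (sum-cong N (λ i _ _ → *-distribˡ-+ (𝟙 (isDes N σ i)) (v i) (w i))) (sum-+ N _ _)

HasStats : ℕ → Perm → ℕ → ℕ → Set
HasStats N σ M T = maj N σ ≡ M × desSum N σ (sizWeight N) ≡ inv N σ + T

siz-from-stats : ∀ {N σ M T} → HasStats N σ M T → siz N σ ≡ + T
siz-from-stats {N} {σ} {M} {T} (_ , W≡I+T) = begin
  + desSum N σ (sizWeight N) ℤ.- + inv N σ  ≡⟨ cong (λ W → + W ℤ.- + inv N σ) W≡I+T ⟩
  + (inv N σ + T) ℤ.- + inv N σ             ≡⟨ ℤ.[+m]-[+n]≡m⊖n (inv N σ + T) (inv N σ) ⟩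
  (inv N σ + T) ℤ.⊖ inv N σ                 ≡⟨ ℤ.⊖-≥ (m≤m+n (inv N σ) T) ⟩
  + (inv N σ + T ∸ inv N σ)                 ≡⟨ cong ℤ.+_ (m+n∸m≡n (inv N σ) T) ⟩
  + T                                       ∎
  where open ≡-Reasoning

module Lift (n : ℕ) (τ : Perm) (into : MapsInto n τ) (τ-fix : τ (suc n) ≡ suc n) where

  -- Below n nothing changes; n itself is no descent since τ(n+1) is maximal.
  isDes-lift : ∀ i → 1 ≤ i → i ≤ n → isDes (suc n) τ i ≡ isDes n τ i
  isDes-lift i 1≤i i≤n with i <? n
  ... | yes i<n rewrite <ᵇ-true i<n | <ᵇ-true (≤-trans i<n (n≤1+n n)) = refl
  ... | no i≮n with ≤-antisym i≤n (≮⇒≥ i≮n)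
  ...   | refl rewrite <ᵇ-false {i} {i} ≤-refl | <ᵇ-true (n<1+n i) | τ-fix =
    <ᵇ-false (≤-trans (into i 1≤i i≤n .proj₂) (n≤1+n i))

  desSum-lift : ∀ w → desSum (suc n) τ w ≡ desSum n τ w
  desSum-lift w rewrite <ᵇ-false {n} {n} ≤-refl =
    trans (+-identityʳ _) (sum-cong n (λ i 1≤i i≤n → cong (λ b → 𝟙 b * w i) (isDes-lift i 1≤i i≤n)))

  -- The new last entry n+1 exceeds every earlier one, so it adds no inversion.
  inv-lift : inv (suc n) τ ≡ inv n τ
  inv-lift = trans (cong (_+_ (inv n τ)) (sum-zero (suc n) _ no-new)) (+-identityʳ _)
    where
    no-new : ∀ i → 1 ≤ i → i ≤ suc n → 𝟙 (i <ᵇ suc n) * 𝟙 (τ (suc n) <ᵇ τ i) ≡ 0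
    no-new i 1≤i _ with i <? suc n
    ... | yes i<N rewrite τ-fix | <ᵇ-false {suc n} {τ i} (≤-trans (into i 1≤i (≤-pred i<N) .proj₂) (n≤1+n n)) =
      *-zeroʳ (𝟙 (i <ᵇ suc n))
    ... | no i≮N rewrite <ᵇ-false (≮⇒≥ i≮N) = refl

  stats-lift : ∀ {M T} → HasStats n τ M T → HasStats (suc n) τ M (T + M)
  stats-lift {M} {T} (maj≡M , W≡I+T) = trans (desSum-lift id) maj≡M , W-lift
    where
    open ≡-Reasoning
    W-lift : desSum (suc n) τ (sizWeight (suc n)) ≡ inv (suc n) τ + (T + M)
    W-lift = begin
      desSum (suc n) τ (sizWeight (suc n))              ≡⟨ desSum-lift (sizWeight (suc n)) ⟩
      desSum n τ (sizWeight (suc n))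
        ≡⟨ desSum-cong n τ (λ i _ i≤n → suc∸-* (suc n) i i (m≤n⇒m≤1+n i≤n)) ⟩
      desSum n τ (λ i → sizWeight n i + i)              ≡⟨ desSum-+ n τ (sizWeight n) id ⟩
      desSum n τ (sizWeight n) + maj n τ                ≡⟨ cong₂ _+_ W≡I+T maj≡M ⟩
      inv n τ + T + M                                   ≡⟨ +-assoc (inv n τ) T M ⟩
      inv n τ + (T + M)                                 ≡⟨ cong (_+ (T + M)) (sym inv-lift) ⟩
      inv (suc n) τ + (T + M)                           ∎

-- The arithmetic of one rotation, with r = N - p and q = p - 1: the weight
-- change of the moved descent is N - 2q, the inversion change N - 1 - 2q.
rotate-arith : ∀ r q W W′ I I′ T →
  W′ + (2 + r) * q ≡ W + (1 + r) * (1 + q) → I′ + q ≡ I + r → W ≡ I + T → W′ ≡ I′ + suc T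
rotate-arith r q W W′ I I′ T desShift invShift refl = +-cancelʳ-≡ ((2 + r) * q) W′ (I′ + suc T) (begin
  W′ + (2 + r) * q                     ≡⟨ desShift ⟩
  I + T + (1 + r) * (1 + q)            ≡⟨ regroup₁ I T r q ⟩
  (I + r) + suc T + (1 + r) * q        ≡⟨ cong (λ x → x + suc T + (1 + r) * q) (sym invShift) ⟩
  (I′ + q) + suc T + (1 + r) * q       ≡⟨ regroup₂ I′ q T r ⟩
  I′ + suc T + (2 + r) * q             ∎)
  where
  open ≡-Reasoning
  regroup₁ : ∀ I T r q → I + T + (1 + r) * (1 + q) ≡ (I + r) + suc T + (1 + r) * q
  regroup₁ = solve-∀
  regroup₂ : ∀ I′ q T r → (I′ + q) + suc T + (1 + r) * q ≡ I′ + suc T + (2 + r) * q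
  regroup₂ = solve-∀

module Rotation (N : ℕ) (ρ : Perm) (perm : IsPermOn N ρ) (q : ℕ) (p<N : suc q < N) (ρp≡1 : ρ (suc q) ≡ 1) where

  open IsPermOn perm

  p : ℕ
  p = suc q

  ρ′ : Perm
  ρ′ = C⁻ N ∘ ρ

  p≤N : p ≤ N
  p≤N = <⇒≤ p<N

  at-least-2 : ∀ j → 1 ≤ j → j ≤ N → j ≢ p → 2 ≤ ρ j
  at-least-2 j 1≤j j≤N j≢p = ≤∧≢⇒< (maps-into j 1≤j j≤N .proj₁) (j≢p ∘ only-p ∘ sym)
    where
    only-p : ρ j ≡ 1 → j ≡ p
    only-p ρj≡1 = trans (sym (left-inverse j 1≤j j≤N))
                        (trans (cong inverse (trans ρj≡1 (sym ρp≡1))) (left-inverse p (s≤s z≤n) p≤N))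

  -- For i ≠ j, [ρ′ j < ρ′ i] + [j = p] = [ρ j < ρ i] + [i = p]: only pairs
  -- involving position p change, and they flip exactly as the deltas record.
  pair-shift : ∀ i j → 1 ≤ i → i ≤ N → 1 ≤ j → j ≤ N → i ≢ j →
    𝟙 (ρ′ j <ᵇ ρ′ i) + 𝟙 (j ≡ᵇ p) ≡ 𝟙 (ρ j <ᵇ ρ i) + 𝟙 (i ≡ᵇ p)
  pair-shift i j 1≤i i≤N 1≤j j≤N i≢j with i ≟ p
  ... | yes refl
    rewrite ρp≡1 | C⁻-below-top N (ρ j) (at-least-2 j 1≤j j≤N (i≢j ∘ sym)) (maps-into j 1≤j j≤N .proj₂)
          | <ᵇ-false {ρ j} {1} (≤-trans (n≤1+n 1) (at-least-2 j 1≤j j≤N (i≢j ∘ sym)))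
          | ≡ᵇ-false (i≢j ∘ sym) | ≡ᵇ-refl q = refl
  ... | no i≢p with j ≟ p
  ...   | yes refl
    rewrite ρp≡1 | C⁻-top-not-below N (ρ i) (at-least-2 i 1≤i i≤N i≢p) (maps-into i 1≤i i≤N .proj₂)
          | <ᵇ-true {1} {ρ i} (at-least-2 i 1≤i i≤N i≢p) | ≡ᵇ-false i≢p | ≡ᵇ-refl q = refl
  ...   | no j≢p
    rewrite C⁻-monotone N (ρ i) (ρ j) (at-least-2 i 1≤i i≤N i≢p) (maps-into i 1≤i i≤N .proj₂)
                                     (at-least-2 j 1≤j j≤N j≢p) (maps-into j 1≤j j≤N .proj₂)
          | ≡ᵇ-false i≢p | ≡ᵇ-false j≢p = refl

  descent-shift : ∀ i → 1 ≤ i → i ≤ N →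
    𝟙 (isDes N ρ′ i) + 𝟙 (i ≡ᵇ q) ≡ 𝟙 (isDes N ρ i) + 𝟙 (i ≡ᵇ p)
  descent-shift i 1≤i i≤N with i <? N
  ... | yes i<N rewrite <ᵇ-true i<N = pair-shift i (suc i) 1≤i i≤N (s≤s z≤n) i<N (<⇒≢ (n<1+n i))
  ... | no i≮N with ≤-antisym i≤N (≮⇒≥ i≮N)
  ...   | refl rewrite <ᵇ-false {i} {i} ≤-refl
                     | ≡ᵇ-false (≢-sym (<⇒≢ (<-trans (n<1+n q) p<N))) | ≡ᵇ-false (≢-sym (<⇒≢ p<N)) = refl

  desSum-shift : ∀ w → w 0 ≡ 0 → desSum N ρ′ w + w q ≡ desSum N ρ w + w p
  desSum-shift w w0≡0 = begin
    desSum N ρ′ w + w q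
      ≡⟨ cong (_+_ (desSum N ρ′ w)) (sym (sum-delta₀ N q w w0≡0 (<⇒≤ (<-trans (n<1+n q) p<N)))) ⟩
    desSum N ρ′ w + sumFrom1 N (λ i → 𝟙 (i ≡ᵇ q) * w i)
      ≡⟨ sym (sum-+ N _ _) ⟩
    sumFrom1 N (λ i → 𝟙 (isDes N ρ′ i) * w i + 𝟙 (i ≡ᵇ q) * w i)
      ≡⟨ sum-cong N pointwise ⟩
    sumFrom1 N (λ i → 𝟙 (isDes N ρ i) * w i + 𝟙 (i ≡ᵇ p) * w i)
      ≡⟨ sum-+ N _ _ ⟩
    desSum N ρ w + sumFrom1 N (λ i → 𝟙 (i ≡ᵇ p) * w i)
      ≡⟨ cong (_+_ (desSum N ρ w)) (sum-delta N p w (s≤s z≤n) p≤N) ⟩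
    desSum N ρ w + w p ∎
    where
    open ≡-Reasoning
    pointwise : ∀ i → 1 ≤ i → i ≤ N →
      𝟙 (isDes N ρ′ i) * w i + 𝟙 (i ≡ᵇ q) * w i ≡ 𝟙 (isDes N ρ i) * w i + 𝟙 (i ≡ᵇ p) * w i
    pointwise i 1≤i i≤N =
      trans (sym (*-distribʳ-+ (w i) (𝟙 (isDes N ρ′ i)) _))
            (trans (cong (_* w i) (descent-shift i 1≤i i≤N)) (*-distribʳ-+ (w i) (𝟙 (isDes N ρ i)) _))

  -- Inversions: the entry at p loses its q inversions with earlier entries
  -- and gains N - p inversions with later ones.
  inv-shift : inv N ρ′ + q ≡ inv N ρ + (N ∸ p)
  inv-shift = begin
    inv N ρ′ + q                                         ≡⟨ cong (_+_ (inv N ρ′)) (sym lost) ⟩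
    inv N ρ′ + sumFrom1 N lostAt                         ≡⟨ sym (sum-+ N _ _) ⟩
    sumFrom1 N (λ j → inversionsAt ρ′ j + lostAt j)      ≡⟨ sum-cong N column ⟩
    sumFrom1 N (λ j → inversionsAt ρ j + gainedAt j)     ≡⟨ sum-+ N _ _ ⟩
    inv N ρ + sumFrom1 N gainedAt                        ≡⟨ cong (_+_ (inv N ρ)) gained ⟩
    inv N ρ + (N ∸ p)                                    ∎
    where
    open ≡-Reasoning
    inversionsAt : Perm → ℕ → ℕ
    inversionsAt σ j = sumFrom1 j (λ i → 𝟙 (i <ᵇ j) * 𝟙 (σ j <ᵇ σ i))
    lostAt gainedAt : ℕ → ℕ
    lostAt j = sumFrom1 j (λ i → 𝟙 (i <ᵇ j) * 𝟙 (j ≡ᵇ p))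
    gainedAt j = sumFrom1 j (λ i → 𝟙 (i <ᵇ j) * 𝟙 (i ≡ᵇ p))

    column : ∀ j → 1 ≤ j → j ≤ N → inversionsAt ρ′ j + lostAt j ≡ inversionsAt ρ j + gainedAt j
    column j 1≤j j≤N = trans (sym (sum-+ j _ _)) (trans (sum-cong j entry) (sum-+ j _ _))
      where
      entry : ∀ i → 1 ≤ i → i ≤ j →
        𝟙 (i <ᵇ j) * 𝟙 (ρ′ j <ᵇ ρ′ i) + 𝟙 (i <ᵇ j) * 𝟙 (j ≡ᵇ p)
          ≡ 𝟙 (i <ᵇ j) * 𝟙 (ρ j <ᵇ ρ i) + 𝟙 (i <ᵇ j) * 𝟙 (i ≡ᵇ p)
      entry i 1≤i i≤j =
        trans (sym (*-distribˡ-+ (𝟙 (i <ᵇ j)) _ _))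
              (trans (𝟙*-cong (i <ᵇ j) (λ i<j → pair-shift i j 1≤i (≤-trans i≤j j≤N) 1≤j j≤N (<⇒≢ (<ᵇ⇒< i j i<j))))
                     (*-distribˡ-+ (𝟙 (i <ᵇ j)) _ _))

    lost : sumFrom1 N lostAt ≡ q
    lost = trans (sum-cong N (λ j _ _ → trans (count-below j (𝟙 (j ≡ᵇ p))) (*-comm (j ∸ 1) _)))
                 (sum-delta N p (_∸ 1) (s≤s z≤n) p≤N)

    gainedAt≡ : ∀ j → gainedAt j ≡ 𝟙 (p <ᵇ j)
    gainedAt≡ j with p ≤? j
    ... | yes p≤j =
      trans (sum-cong j (λ i _ _ → *-comm (𝟙 (i <ᵇ j)) _)) (sum-delta j p (λ i → 𝟙 (i <ᵇ j)) (s≤s z≤n) p≤j)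
    ... | no p≰j rewrite <ᵇ-false {p} {j} (<⇒≤ (≰⇒> p≰j)) =
      trans (sum-cong j (λ i _ _ → *-comm (𝟙 (i <ᵇ j)) _)) (sum-delta-out j p (λ i → 𝟙 (i <ᵇ j)) (≰⇒> p≰j))

    gained : sumFrom1 N gainedAt ≡ N ∸ p
    gained = trans (sum-cong N (λ j _ _ → gainedAt≡ j)) (count-above N p)

  stats-rotate : ∀ {M T} → HasStats N ρ M T → HasStats N ρ′ (suc M) (suc T)
  stats-rotate {M} {T} (maj≡M , W≡I+T) =
    +-cancelʳ-≡ q _ _ (trans (desSum-shift id refl) (trans (cong (_+ p) maj≡M) (+-suc M q))) ,
    rotate-arith (N ∸ p) q _ _ _ _ T W-shift inv-shift W≡I+T
    where
    N∸q : N ∸ q ≡ suc (N ∸ p)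
    N∸q = +-∸-assoc 1 p≤N
    sucN∸q : suc N ∸ q ≡ 2 + (N ∸ p)
    sucN∸q = trans (+-∸-assoc 1 (<⇒≤ (<-trans (n<1+n q) p<N))) (cong suc N∸q)
    W-shift : desSum N ρ′ (sizWeight N) + (2 + (N ∸ p)) * q ≡ desSum N ρ (sizWeight N) + (1 + (N ∸ p)) * (1 + q)
    W-shift = begin
      desSum N ρ′ (sizWeight N) + (2 + (N ∸ p)) * q
        ≡⟨ cong (λ x → desSum N ρ′ (sizWeight N) + x * q) (sym sucN∸q) ⟩
      desSum N ρ′ (sizWeight N) + sizWeight N q
        ≡⟨ desSum-shift (sizWeight N) (*-zeroʳ (suc N)) ⟩
      desSum N ρ (sizWeight N) + sizWeight N p
        ≡⟨ cong (λ x → desSum N ρ (sizWeight N) + x * p) N∸q ⟩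
      desSum N ρ (sizWeight N) + (1 + (N ∸ p)) * (1 + q) ∎
      where open ≡-Reasoning

stats-rotate : ∀ {N ρ M T} → 1 ≤ N → IsPermOn N ρ → ρ N ≢ 1 →
  HasStats N ρ M T → HasStats N (C⁻ N ∘ ρ) (suc M) (suc T)
stats-rotate {N} {ρ} 1≤N perm ρN≢1 = at (inverse 1) (inverse-maps-into 1 ≤-refl 1≤N) (right-inverse 1 ≤-refl 1≤N)
  where
  open IsPermOn perm
  at : ∀ p → 1 ≤ p × p ≤ N → ρ p ≡ 1 → ∀ {M T} → HasStats N ρ M T → HasStats N (C⁻ N ∘ ρ) (suc M) (suc T)
  at (suc q) (_ , p≤N) ρp≡1 with suc q ≟ N
  ... | yes refl = ⊥-elim (ρN≢1 ρp≡1)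
  ... | no p≢N = Rotation.stats-rotate N ρ perm q (≤∧≢⇒< p≤N p≢N) ρp≡1

-- Starting from τ ∈ S_N fixing N = n+1, k ≤ n rotations raise maj and siz by k,
-- since after j < k rotations the last entry is N - j ≥ 2.
stats-rotations : ∀ n τ → IsPermOn (suc n) τ → τ (suc n) ≡ suc n → ∀ {M T} → HasStats (suc n) τ M T →
  ∀ k → k ≤ n → HasStats (suc n) ((C⁻ (suc n) ^ᵖ k) ∘ τ) (M + k) (T + k)
stats-rotations n τ perm τ-fix {M} {T} stats zero _ =
  subst₂ (HasStats (suc n) τ) (sym (+-identityʳ M)) (sym (+-identityʳ T)) stats
stats-rotations n τ perm τ-fix {M} {T} stats (suc k) k<n =
  subst₂ (HasStats (suc n) ((C⁻ (suc n) ^ᵖ suc k) ∘ τ)) (sym (+-suc M k)) (sym (+-suc T k))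
    (stats-rotate (s≤s z≤n) (∘-perm (^-perm k (C⁻-perm (suc n) (suc n) (s≤s z≤n) ≤-refl)) perm) last≢1
      (stats-rotations n τ perm τ-fix stats k (≤-trans (n≤1+n k) k<n)))
  where
  last≡ : (C⁻ (suc n) ^ᵖ k) (τ (suc n)) ≡ suc n ∸ k
  last≡ = trans (cong (C⁻ (suc n) ^ᵖ k) τ-fix) (C⁻^-top (suc n) k (s≤s k<n))
  last≢1 : (C⁻ (suc n) ^ᵖ k) (τ (suc n)) ≢ 1
  last≢1 last≡1 = <⇒≢ (m+n≤o⇒m≤o∸n 2 (s≤s k<n)) (trans (sym last≡1) last≡)

weights-suc : ∀ n (a : ℕ → ℕ) → sumFrom1 (suc n) (λ i → (suc (suc n) ∸ i) * a i) ≡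
  (sumFrom1 n (λ i → (suc n ∸ i) * a i) + sumFrom1 n a) + a (suc n)
weights-suc n a = cong₂ _+_ (trans (sum-cong n (λ i _ i≤n → suc∸-* (suc n) i (a i) (m≤n⇒m≤1+n i≤n))) (sum-+ n _ _))
                            (trans (cong (_* a (suc n)) (m+n∸n≡m 1 n)) (+-identityʳ _))

σseq-stats : ∀ m (a : ℕ → ℕ) → (∀ i → 1 ≤ i → i ≤ suc m → a i < i) →
  HasStats (suc m) (σseq a (suc m)) (sumFrom1 (suc m) a) (sumFrom1 (suc m) (λ i → (suc (suc m) ∸ i) * a i))
σseq-stats zero a a<i rewrite n<1⇒n≡0 (a<i 1 ≤-refl ≤-refl) = refl , refl
σseq-stats (suc m) a a<i =
  subst (HasStats (suc n) (σseq a (suc n)) (sumFrom1 (suc n) a)) (sym (weights-suc n a))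
    (stats-rotations n τ (σseq-perm a n (suc n) (n≤1+n n)) τ-fix
      (Lift.stats-lift n τ (IsPermOn.maps-into (σseq-perm a n n ≤-refl)) τ-fix
        (σseq-stats m a (λ i 1≤i i≤n → a<i i 1≤i (m≤n⇒m≤1+n i≤n))))
      (a (suc n)) (≤-pred (a<i (suc n) (s≤s z≤n) ≤-refl)))
  where
  n : ℕ
  n = suc m
  τ : Perm
  τ = σseq a n
  τ-fix : τ (suc n) ≡ suc n
  τ-fix = σseq-fix a n (suc n) ≤-refl

mainTheorem10 : (n : ℕ) → 1 ≤ n → (a : ℕ → ℕ) →
    (∀ i → 1 ≤ i → i ≤ n → a i < i) →
    (maj n (σseq a n) ≡ sumFrom1 n a)
    × (siz n (σseq a n) ≡ + sumFrom1 n (λ i → (suc n ∸ i) * a i))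
mainTheorem10 (suc m) _ a a<i = proj₁ stats , siz-from-stats {suc m} {σseq a (suc m)} stats
  where
  stats : HasStats (suc m) (σseq a (suc m)) (sumFrom1 (suc m) a) (sumFrom1 (suc m) (λ i → (suc (suc m) ∸ i) * a i))
  stats = σseq-stats m a a<i
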